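{- Let $\eta=(\eta_1,\dots,\eta_p)$ be a composition of $n$ with positive parts and let $\gamma\in\mathbb{Z}^n$ with $\gamma_1+\cdots+\gamma_n=0$. Then $K_{\Phi(\eta)}(\gamma\mid q)\neq0$ if and only if $\gamma\in Y_\eta$. Moreover, in that case $$\deg_q K_{\Phi(\eta)}(\gamma\mid q)=\sum_{k=1}^{p-1}(p-k)\sum_{j=r_{k-1}+1}^{r_k}\gamma_j .$$
   Context: $r_k=\eta_1+\cdots+\eta_k$ for $k\ge1$, $r_0=0$. $\Phi(\eta)=\{(i,j)\in\mathbb{Z}^2:1\le i\le r_k<j\le n\text{ for some }1\le k\le p\}$. $K_{\Phi(\eta)}(\gamma\mid q)$ is the coefficient of $x^\gamma$ in $\prod_{(i,j)\in\Phi(\eta)}(1-qx_i/x_j)^{ -1}=\prod\sum_{m\ge0}q^m(x_i/x_j)^m$. $Y_\eta$ is the set of $\gamma\in\mathbb{Z}^n$ with $\sum_i\gamma_i=0$ such that for each $k$ with $0\le k\le p-1$ and every subset $\Omega_k\subseteq\{r_k+1,\dots,r_{k+1}\}$ one has $\sum_{j=1}^{r_k}\gamma_j+\sum_{a\in\Omega_k}\gamma_a\ge0$. -}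

module Defs where

open import Data.Nat as ℕ using (ℕ; zero; suc; _∸_; _<?_; _≤?_)
open import Data.Integer as ℤ using (ℤ; +_; 0ℤ; _-_; _+_; _*_; _≤_)
open import Data.Fin using (Fin; toℕ; _≟_)
open import Data.Fin.Subset using (Subset; _∈_)
open import Data.List as List using (List; []; _∷_; map; concatMap; upTo; allFin; filter; take; cartesianProduct; zip; foldr; length)
open import Data.List.Relation.Unary.Any using (Any; any?)
open import Data.Vec as Vec using (Vec; tabulate; lookup)
open import Data.Vec.Properties using (≡-dec)
import Data.Nat.ListAction as ListAction
open import Data.Product using (_×_; _,_; ∃)
open import Data.Bool using (if_then_else_)
open import Relation.Nullary using (¬_; does)
open import Relation.Nullary.Decidable using (_×-dec_)
open import Relation.Binary.PropositionalEquality using (_≡_)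

-- Indices are 0-based: the paper's index i ∈ {1..n} is Fin n element with toℕ = i-1.

r : List ℕ → ℕ → ℕ
r η k = ListAction.sum (take k η)

partialSums : List ℕ → List ℕ
partialSums η = map (λ k → r η (suc k)) (upTo (List.length η))

-- (i,j) ∈ Φ(η)  iff  1 ≤ i ≤ r_k < j ≤ n for some 1 ≤ k ≤ p   (0-based: toℕ i < r_k ≤ toℕ j)
InΦ : ∀ {n} → List ℕ → Fin n × Fin n → Set
InΦ η (i , j) = Any (λ rk → (toℕ i ℕ.< rk) × (rk ℕ.≤ toℕ j)) (partialSums η)

Φ : (n : ℕ) → List ℕ → List (Fin n × Fin n)
Φ n η = filter (λ ij → any? (λ rk → (toℕ (Data.Product.proj₁ ij) <? rk) ×-dec (rk ≤? toℕ (Data.Product.proj₂ ij))) (partialSums η))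
               (cartesianProduct (allFin n) (allFin n))

comps : ℕ → ℕ → List (List ℕ)
comps zero zero = [] ∷ []
comps zero (suc _) = []
comps (suc l) d = concatMap (λ a → map (a ∷_) (comps l (d ∸ a))) (upTo (suc d))

-- exponent vector of the monomial ∏ (x_i/x_j)^{m_ij}
contrib : ∀ {n} → Fin n → (Fin n × Fin n) × ℕ → ℤ
contrib t ((i , j) , m) = (if does (i ≟ t) then + m else 0ℤ) - (if does (j ≟ t) then + m else 0ℤ)

weight : ∀ {n} → List (Fin n × Fin n) → List ℕ → Vec ℤ n
weight ps ms = tabulate (λ t → foldr _+_ 0ℤ (map (contrib t) (zip ps ms)))

-- coefficient of q^d x^γ in ∏_{(i,j)∈Φ(η)} (1 - q x_i/x_j)^{-1}
-- = number of m : Φ(η) → ℕ with Σ m = d and Σ m_ij (e_i - e_j) = γ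
Kcoeff : ∀ {n} → List ℕ → Vec ℤ n → ℕ → ℕ
Kcoeff {n} η γ d =
  length (filter (λ ms → ≡-dec ℤ._≟_ (weight (Φ n η) ms) γ) (comps (length (Φ n η)) d))

KNonZero : ∀ {n} → List ℕ → Vec ℤ n → Set
KNonZero η γ = ∃ λ d → ¬ (Kcoeff η γ d ≡ 0)

IsDegree : (ℕ → ℕ) → ℕ → Set
IsDegree c D = ¬ (c D ≡ 0) × (∀ d → D ℕ.< d → c d ≡ 0)

sumFin : ∀ {n} → (Fin n → ℤ) → ℤ
sumFin {n} f = foldr _+_ 0ℤ (map f (allFin n))

sumVec : ∀ {n} → Vec ℤ n → ℤ
sumVec γ = sumFin (lookup γ)

-- Σ_{j=lo+1}^{hi} γ_j  (1-based), i.e. over 0-based j with lo ≤ j < hi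
rangeSum : ∀ {n} → Vec ℤ n → ℕ → ℕ → ℤ
rangeSum γ lo hi = sumFin (λ j → if does (lo ≤? toℕ j) then (if does (toℕ j <? hi) then lookup γ j else 0ℤ) else 0ℤ)

subsetSum : ∀ {n} → Vec ℤ n → Subset n → ℤ
subsetSum γ Ω = sumFin (λ a → if lookup Ω a then lookup γ a else 0ℤ)

-- γ ∈ Y_η (the condition Σγ = 0 is assumed separately in the theorem, but included here too)
InY : ∀ {n} → List ℕ → Vec ℤ n → Set
InY {n} η γ = (sumVec γ ≡ 0ℤ) ×
  (∀ (k : ℕ) → k ℕ.< length η → ∀ (Ω : Subset n) →
     (∀ (a : Fin n) → a ∈ Ω → (r η k ℕ.≤ toℕ a) × (toℕ a ℕ.< r η (suc k))) →
     0ℤ ≤ (rangeSum γ 0 (r η k) + subsetSum γ Ω))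

degFormula : ∀ {n} → List ℕ → Vec ℤ n → ℤ
degFormula η γ = foldr _+_ 0ℤ
  (map (λ k → + (p ∸ k) * rangeSum γ (r η (k ∸ 1)) (r η k)) (map suc (upTo (p ∸ 1))))
  where p = length η

{-# OPTIONS --safe #-}
module Submission where

-- A coefficient of q^d x^γ counts the multiplicities m : Φ(η) → ℕ with Σ m = d whose divergence
-- Σ m_ij (e_i − e_j) is γ.  For a set A of indices that is closed under predecessors along Φ(η), the sum
-- Σ_{t∈A} γ_t is the flow leaving A, hence ≥ 0; the sets {1..r_k} ∪ Ω_k in the definition of Y_η are of
-- this kind, which gives necessity.  Every edge of Φ(η) leaves one of the prefixes {1..r_k}, 1 ≤ k < p,
-- so Σ m ≤ Σ_k S_k with S_k = γ_1 + ⋯ + γ_{r_k}, and Σ_k S_k is the degree formula after summation by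
-- parts.  Conversely, if γ ∈ Y_η and Σ_k S_k > 0 then S_c < S_{c+1} for some c; moving one unit from a
-- positive entry i of block c+1 to a suitable entry j of block c+2 (γ ↦ γ − e_i + e_j) stays in Y_η and
-- lowers Σ_k S_k by one, while Σ_k S_k = 0 forces γ = 0.  By induction there is a flow with
-- Σ m = Σ_k S_k, which is therefore the degree.

open import Defs
open import Data.Nat as ℕ using (ℕ; zero; suc; z≤n; s≤s; _∸_)
import Data.Nat.Properties as ℕP
open import Data.Nat.ListAction using (sum)
open import Data.Integer as ℤ using (ℤ; +_; 0ℤ; 1ℤ; _+_; _-_; -_; _*_; _≤_; _<_; +≤+; +<+)
import Data.Integer.Properties as ℤP
open import Data.Integer.Tactic.RingSolver using (solve-∀)
open import Algebra.Properties.CommutativeMonoid.Sum ℤP.+-0-commutativeMonoid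
  using (sum-syntax; sum-cong-≗; sum-remove; sum-replicate-zero; ∑-distrib-+)
open import Data.Fin using (Fin; zero; suc; toℕ; fromℕ<; punchIn; _≟_)
import Data.Fin.Properties as FinP
open import Data.Bool using (Bool; true; false; if_then_else_; _∨_; _∧_; not)
import Data.Bool.Properties as BoolP
open import Data.Vec as Vec using (Vec; lookup)
open import Data.Fin.Subset using (Subset) renaming (_∈_ to _∈ₛ_)
import Data.Vec.Properties as VecP
open import Data.List as List using (List; []; _∷_; map; foldr; zip; filter; replicate; length; applyUpTo; upTo)
import Data.List.Properties as ListP
open import Data.List.Membership.Propositional using (_∈_; find; lose)
open import Data.List.Membership.Propositional.Properties
  using (∈-concatMap⁺; ∈-concatMap⁻; ∈-map⁺; ∈-map⁻; ∈-upTo⁺; ∈-upTo⁻; ∈-filter⁺; ∈-filter⁻;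
         ∈-cartesianProduct⁺; ∈-allFin)
open import Data.List.Relation.Unary.Any using (Any; any?; here; there)
import Data.List.Relation.Unary.Any.Properties as AnyP
open import Data.List.Relation.Unary.All as All using (All)
open import Data.List.Relation.Unary.All.Properties using (¬Any⇒All¬)
open import Data.Product using (_×_; _,_; ∃; proj₁; proj₂; uncurry)
open import Data.Sum using (_⊎_; inj₁; inj₂)
open import Relation.Nullary using (¬_; Dec; yes; no; does; contradiction)
open import Relation.Nullary.Decidable using (dec-true; dec-false; decidable-stable; _×-dec_)
open import Relation.Unary using (Decidable)
open import Relation.Binary.PropositionalEquality
open import Relation.Binary.Definitions using (tri<; tri≈; tri>)
open import Function using (_∘_; id; flip)
open import Function.Bundles using (_⇔_; mk⇔)

∑-distrib-- : ∀ {n} (f g : Fin n → ℤ) → ∑[ t < n ] (f t - g t) ≡ ∑[ t < n ] f t - ∑[ t < n ] g t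
∑-distrib-- {zero} f g = refl
∑-distrib-- {suc n} f g =
  trans (cong (_+_ (f zero - g zero)) (∑-distrib-- (f ∘ suc) (g ∘ suc)))
        (interchange (f zero) (g zero) (∑[ t < n ] f (suc t)) (∑[ t < n ] g (suc t)))
  where
  interchange : ∀ a b c d → (a - b) + (c - d) ≡ (a + c) - (b + d)
  interchange = solve-∀

∑-single : ∀ {n} {f : Fin n → ℤ} i → (∀ t → t ≢ i → f t ≡ 0ℤ) → ∑[ t < n ] f t ≡ f i
∑-single {suc n} {f} i f≡0 = begin
  ∑[ t < suc n ] f t                 ≡⟨ sum-remove {i = i} f ⟩
  f i + ∑[ t < n ] f (punchIn i t)   ≡⟨ cong (_+_ (f i)) (sum-cong-≗ (λ t → f≡0 _ (FinP.punchInᵢ≢i i t))) ⟩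
  f i + ∑[ t < n ] 0ℤ                ≡⟨ cong (_+_ (f i)) (sum-replicate-zero n) ⟩
  f i + 0ℤ                           ≡⟨ ℤP.+-identityʳ (f i) ⟩
  f i                                ∎
  where open ≡-Reasoning

∑-mono-≤ : ∀ {n} {f g : Fin n → ℤ} → (∀ t → f t ≤ g t) → ∑[ t < n ] f t ≤ ∑[ t < n ] g t
∑-mono-≤ {zero} _ = ℤP.≤-refl
∑-mono-≤ {suc n} f≤g = ℤP.+-mono-≤ (f≤g zero) (∑-mono-≤ (f≤g ∘ suc))

∑-nonneg : ∀ {n} {f : Fin n → ℤ} → (∀ t → 0ℤ ≤ f t) → 0ℤ ≤ ∑[ t < n ] f t
∑-nonneg {n} {f} 0≤f = subst (_≤ ∑[ t < n ] f t) (sum-replicate-zero n) (∑-mono-≤ 0≤f)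

∑-pos⇒∃-pos : ∀ {n} {f : Fin n → ℤ} → 0ℤ < ∑[ t < n ] f t → ∃ λ t → 0ℤ < f t
∑-pos⇒∃-pos {n} {f} 0<∑ with FinP.any? (λ t → 0ℤ ℤP.<? f t)
... | yes found = found
... | no none = contradiction 0<∑ (ℤP.≤⇒≯ (subst (∑[ t < n ] f t ≤_) (sum-replicate-zero n) ∑f≤0))
  where
  ∑f≤0 : ∑[ t < n ] f t ≤ ∑[ t < n ] 0ℤ
  ∑f≤0 = ∑-mono-≤ (λ t → ℤP.≮⇒≥ (none ∘ (t ,_)))

term≤∑ : ∀ {n} {f : Fin n → ℤ} → (∀ t → 0ℤ ≤ f t) → ∀ i → f i ≤ ∑[ t < n ] f t
term≤∑ {suc n} {f} 0≤f i = begin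
  f i                                ≡⟨ ℤP.+-identityʳ (f i) ⟨
  f i + 0ℤ                           ≤⟨ ℤP.+-monoʳ-≤ (f i) (∑-nonneg (0≤f ∘ punchIn i)) ⟩
  f i + ∑[ t < n ] f (punchIn i t)   ≡⟨ sum-remove {i = i} f ⟨
  ∑[ t < suc n ] f t                 ∎
  where open ℤP.≤-Reasoning

foldr-+-tabulate : ∀ {n} (f : Fin n → ℤ) → foldr _+_ 0ℤ (List.tabulate f) ≡ ∑[ t < n ] f t
foldr-+-tabulate {zero} f = refl
foldr-+-tabulate {suc n} f = cong (_+_ (f zero)) (foldr-+-tabulate (f ∘ suc))

sumFin≡∑ : ∀ {n} (f : Fin n → ℤ) → sumFin f ≡ ∑[ t < n ] f t
sumFin≡∑ f = trans (cong (foldr _+_ 0ℤ) (ListP.map-tabulate id f)) (foldr-+-tabulate f)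

applyUpTo≡tabulate : ∀ {A : Set} (f : ℕ → A) m → applyUpTo f m ≡ List.tabulate {n = m} (f ∘ toℕ)
applyUpTo≡tabulate f zero = refl
applyUpTo≡tabulate f (suc m) = cong (f 0 ∷_) (applyUpTo≡tabulate (f ∘ suc) m)

∑-single-toℕ : ∀ {m} {f : ℕ → ℤ} {c} → c ℕ.< m → (∀ k → k ≢ c → f k ≡ 0ℤ) →
  ∑[ k < m ] f (toℕ k) ≡ f c
∑-single-toℕ {f = f} c<m f≡0 =
  trans (∑-single (fromℕ< c<m) λ k k≢c →
           f≡0 (toℕ k) (k≢c ∘ FinP.toℕ-injective ∘ flip trans (sym (FinP.toℕ-fromℕ< c<m))))
        (cong f (FinP.toℕ-fromℕ< c<m))

term≤∑-toℕ : ∀ {m} {f : ℕ → ℤ} → (∀ k → 0ℤ ≤ f k) → ∀ {c} → c ℕ.< m → f c ≤ ∑[ k < m ] f (toℕ k)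
term≤∑-toℕ {m} {f} 0≤f c<m =
  subst (_≤ ∑[ k < m ] f (toℕ k)) (cong f (FinP.toℕ-fromℕ< c<m)) (term≤∑ (0≤f ∘ toℕ) (fromℕ< c<m))

∑-weighted-differences : ∀ m (h : ℕ → ℤ) →
  ∑[ x < m ] (+ (m ∸ toℕ x) * (h (suc (toℕ x)) - h (toℕ x))) ≡ ∑[ k < suc m ] h (toℕ k) - + suc m * h 0
∑-weighted-differences zero    h = cancel (h 0)
  where
  cancel : ∀ h₀ → 0ℤ ≡ (h₀ + 0ℤ) - 1ℤ * h₀
  cancel = solve-∀
∑-weighted-differences (suc m) h =
  trans (cong (_+_ (+ suc m * (h 1 - h 0))) (∑-weighted-differences m (h ∘ suc)))
        (regroup (+ m) (h 0) (h 1) (∑[ k < suc m ] h (suc (toℕ k))))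
  where
  regroup : ∀ M h₀ h₁ s → (1ℤ + M) * (h₁ - h₀) + (s - (1ℤ + M) * h₁) ≡ (h₀ + s) - (1ℤ + (1ℤ + M)) * h₀
  regroup = solve-∀

∑-by-parts : ∀ p (h : ℕ → ℤ) → h 0 ≡ 0ℤ →
  ∑[ x < p ∸ 1 ] (+ (p ∸ suc (toℕ x)) * (h (suc (toℕ x)) - h (toℕ x))) ≡ ∑[ k < p ] h (toℕ k)
∑-by-parts zero    h _    = refl
∑-by-parts (suc m) h h0≡0 = begin
  ∑[ x < m ] (+ (m ∸ toℕ x) * (h (suc (toℕ x)) - h (toℕ x)))  ≡⟨ ∑-weighted-differences m h ⟩
  H - + suc m * h 0                                           ≡⟨ cong (λ z → H - + suc m * z) h0≡0 ⟩
  H - + suc m * 0ℤ                                            ≡⟨ cong (_-_ H) (ℤP.*-zeroʳ (+ suc m)) ⟩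
  H - 0ℤ                                                      ≡⟨ ℤP.+-identityʳ H ⟩
  H                                                           ∎
  where
  open ≡-Reasoning
  H = ∑[ k < suc m ] h (toℕ k)

ascent : ∀ (f : ℕ → ℤ) k → f 0 < f k → ∃ λ c → c ℕ.< k × f c < f (suc c)
ascent f zero    f0<f0 = contradiction f0<f0 (ℤP.<-irrefl refl)
ascent f (suc k) f0<fk with f k ℤP.<? f (suc k)
... | yes up = k , ℕP.n<1+n k , up
... | no ¬up = let c , c<k , up = ascent f k (ℤP.<-≤-trans f0<fk (ℤP.≮⇒≥ ¬up)) in c , ℕP.m<n⇒m<1+n c<k , up

squeeze : ∀ {c l} → c ℕ.≤ l → l ℕ.≤ suc c → l ≡ c ⊎ l ≡ suc c
squeeze c≤l l≤sc with ℕP.m≤n⇒m<n∨m≡n c≤l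
... | inj₁ c<l = inj₂ (ℕP.≤-antisym l≤sc c<l)
... | inj₂ c≡l = inj₁ (sym c≡l)

does-true⇒ : ∀ {P : Set} (P? : Dec P) → does P? ≡ true → P
does-true⇒ (yes p) _ = p

does-false⇒ : ∀ {P : Set} (P? : Dec P) → does P? ≡ false → ¬ P
does-false⇒ (no ¬p) _ = ¬p

infixr 8 [_]·_

[_]·_ : Bool → ℤ → ℤ
[ b ]· x = if b then x else 0ℤ

·-zero : ∀ b → [ b ]· 0ℤ ≡ 0ℤ
·-zero true = refl
·-zero false = refl

·-distrib-+ : ∀ b x y → [ b ]· (x + y) ≡ [ b ]· x + [ b ]· y
·-distrib-+ true x y = refl
·-distrib-+ false x y = refl

·-distrib-- : ∀ b x y → [ b ]· (x - y) ≡ [ b ]· x - [ b ]· y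
·-distrib-- true x y = refl
·-distrib-- false x y = refl

·-comm : ∀ a b x → [ a ]· [ b ]· x ≡ [ b ]· [ a ]· x
·-comm true b x = refl
·-comm false true x = refl
·-comm false false x = refl

·-∧ : ∀ a b x → [ a ]· [ b ]· x ≡ [ a ∧ b ]· x
·-∧ true b x = refl
·-∧ false b x = refl

module _ {n : ℕ} where

  infixl 6 _∪_ _∖_
  infix 4 _⊆_

  _∪_ _∖_ : (Fin n → Bool) → (Fin n → Bool) → Fin n → Bool
  (A ∪ B) t = A t ∨ B t
  (A ∖ B) t = A t ∧ not (B t)

  ⁅_⁆ : Fin n → Fin n → Bool
  ⁅ i ⁆ t = does (i ≟ t)

  _⊆_ : (Fin n → Bool) → (Fin n → Bool) → Set
  A ⊆ B = ∀ {t} → A t ≡ true → B t ≡ true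

  Disjoint : (Fin n → Bool) → (Fin n → Bool) → Set
  Disjoint A B = ∀ {t} → A t ≡ true → B t ≡ false

  ⁅⁆⁻ : ∀ {i t} → ⁅ i ⁆ t ≡ true → i ≡ t
  ⁅⁆⁻ {i} {t} = does-true⇒ (i ≟ t)

  sumOn : (Fin n → Bool) → (Fin n → ℤ) → ℤ
  sumOn A g = ∑[ t < n ] ([ A t ]· g t)

  sumOn-congˡ : ∀ {A B} g → (∀ t → A t ≡ B t) → sumOn A g ≡ sumOn B g
  sumOn-congˡ g A≗B = sum-cong-≗ (λ t → cong ([_]· g t) (A≗B t))

  sumOn-congʳ : ∀ A {g h} → (∀ t → g t ≡ h t) → sumOn A g ≡ sumOn A h
  sumOn-congʳ A g≗h = sum-cong-≗ (λ t → cong ([ A t ]·_) (g≗h t))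

  sumOn-+ : ∀ A f g → sumOn A (λ t → f t + g t) ≡ sumOn A f + sumOn A g
  sumOn-+ A f g = trans (sum-cong-≗ (λ t → ·-distrib-+ (A t) (f t) (g t)))
                        (∑-distrib-+ (λ t → [ A t ]· f t) (λ t → [ A t ]· g t))

  sumOn-- : ∀ A f g → sumOn A (λ t → f t - g t) ≡ sumOn A f - sumOn A g
  sumOn-- A f g = trans (sum-cong-≗ (λ t → ·-distrib-- (A t) (f t) (g t)))
                        (∑-distrib-- (λ t → [ A t ]· f t) (λ t → [ A t ]· g t))

  sumOn-zero : ∀ A → sumOn A (λ _ → 0ℤ) ≡ 0ℤ
  sumOn-zero A = trans (sum-cong-≗ (·-zero ∘ A)) (sum-replicate-zero n)

  sumOn-∪ : ∀ {A B} g → Disjoint A B → sumOn (A ∪ B) g ≡ sumOn A g + sumOn B g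
  sumOn-∪ {A} {B} g A∩B≡∅ = trans (sum-cong-≗ pointwise) (∑-distrib-+ (λ t → [ A t ]· g t) (λ t → [ B t ]· g t))
    where
    pointwise : ∀ t → [ A t ∨ B t ]· g t ≡ [ A t ]· g t + [ B t ]· g t
    pointwise t with A t in At | B t in Bt
    ... | true  | true  = contradiction (trans (sym Bt) (A∩B≡∅ At)) λ ()
    ... | true  | false = sym (ℤP.+-identityʳ (g t))
    ... | false | b     = sym (ℤP.+-identityˡ ([ b ]· g t))

  sumOn-⁅⁆ : ∀ i g → sumOn ⁅ i ⁆ g ≡ g i
  sumOn-⁅⁆ i g = trans (∑-single i (λ t t≢i → cong ([_]· g t) (dec-false (i ≟ t) (t≢i ∘ sym))))
                       (cong ([_]· g i) (dec-true (i ≟ i) refl))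

  sumOn-·⁅⁆ : ∀ A i x → sumOn A (λ t → [ ⁅ i ⁆ t ]· x) ≡ [ A i ]· x
  sumOn-·⁅⁆ A i x = trans (sum-cong-≗ (λ t → ·-comm (A t) (⁅ i ⁆ t) x)) (sumOn-⁅⁆ i (λ t → [ A t ]· x))

  sumOn-insert : ∀ {A j} g → A j ≡ false → sumOn (A ∪ ⁅ j ⁆) g ≡ sumOn A g + g j
  sumOn-insert {A} {j} g Aj≡false = trans (sumOn-∪ g disjoint) (cong (_+_ (sumOn A g)) (sumOn-⁅⁆ j g))
    where
    disjoint : Disjoint A ⁅ j ⁆
    disjoint {t} At≡true = dec-false (j ≟ t) λ { refl → contradiction (trans (sym Aj≡false) At≡true) λ () }

  sumOn-split : ∀ {A B} g → B ⊆ A → sumOn A g ≡ sumOn B g + sumOn (A ∖ B) g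
  sumOn-split {A} {B} g B⊆A = trans (sumOn-congˡ g reassemble) (sumOn-∪ g disjoint)
    where
    reassemble : ∀ t → A t ≡ (B ∪ (A ∖ B)) t
    reassemble t with B t in Bt
    ... | true  = B⊆A Bt
    ... | false = sym (BoolP.∧-identityʳ (A t))
    disjoint : Disjoint B (A ∖ B)
    disjoint {t} Bt rewrite Bt = BoolP.∧-zeroʳ (A t)

  sumOn-remove : ∀ {A i} g → A i ≡ true → sumOn A g ≡ g i + sumOn (A ∖ ⁅ i ⁆) g
  sumOn-remove {A} {i} g Ai≡true =
    trans (sumOn-split g (λ i≡t → subst (λ u → A u ≡ true) (⁅⁆⁻ i≡t) Ai≡true))
          (cong (_+ sumOn (A ∖ ⁅ i ⁆) g) (sumOn-⁅⁆ i g))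

  sumOn-mono : ∀ {A B g} → A ⊆ B → (∀ {t} → B t ≡ true → A t ≡ false → 0ℤ ≤ g t) → sumOn A g ≤ sumOn B g
  sumOn-mono {A} {B} {g} A⊆B extra≥0 = ∑-mono-≤ pointwise
    where
    pointwise : ∀ t → [ A t ]· g t ≤ [ B t ]· g t
    pointwise t with A t in At | B t in Bt
    ... | true  | true  = ℤP.≤-refl
    ... | true  | false = contradiction (trans (sym (A⊆B At)) Bt) λ ()
    ... | false | true  = extra≥0 Bt At
    ... | false | false = ℤP.≤-refl

  sumOn-pos⇒∃ : ∀ A g → 0ℤ < sumOn A g → ∃ λ t → A t ≡ true × 0ℤ < g t
  sumOn-pos⇒∃ A g 0<sum with ∑-pos⇒∃-pos 0<sum
  ... | t , 0<Agt with A t in At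
  ...   | true  = t , At , 0<Agt
  ...   | false = contradiction 0<Agt (ℤP.<-irrefl refl)

  below : ℕ → Fin n → Bool
  below R t = does (toℕ t ℕ.<? R)

  between : ℕ → ℕ → Fin n → Bool
  between lo hi t = does (lo ℕ.≤? toℕ t) ∧ below hi t

  below⁺ : ∀ {R t} → toℕ t ℕ.< R → below R t ≡ true
  below⁺ {R} {t} = dec-true (toℕ t ℕ.<? R)

  below⁻ : ∀ {R t} → below R t ≡ true → toℕ t ℕ.< R
  below⁻ {R} {t} = does-true⇒ (toℕ t ℕ.<? R)

  ¬below⁺ : ∀ {R t} → R ℕ.≤ toℕ t → below R t ≡ false
  ¬below⁺ {R} {t} R≤t = dec-false (toℕ t ℕ.<? R) (ℕP.≤⇒≯ R≤t)

  ¬below⁻ : ∀ {R t} → below R t ≡ false → R ℕ.≤ toℕ t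
  ¬below⁻ {R} {t} = ℕP.≮⇒≥ ∘ does-false⇒ (toℕ t ℕ.<? R)

  between⁻ : ∀ {lo hi t} → between lo hi t ≡ true → lo ℕ.≤ toℕ t × toℕ t ℕ.< hi
  between⁻ {lo} {hi} {t} inside =
    does-true⇒ (lo ℕ.≤? toℕ t) (BoolP.∧-conicalˡ _ _ inside) , below⁻ (BoolP.∧-conicalʳ _ _ inside)

  sumBelow : (Fin n → ℤ) → ℕ → ℤ
  sumBelow g R = sumOn (below R) g

  sumBelow-0 : ∀ g → sumBelow g 0 ≡ 0ℤ
  sumBelow-0 g = trans (sumOn-congˡ {B = λ _ → false} g (λ t → ¬below⁺ {t = t} z≤n)) (sum-replicate-zero n)

  sumBelow-full : ∀ g {R} → n ℕ.≤ R → sumBelow g R ≡ ∑[ t < n ] g t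
  sumBelow-full g n≤R = sumOn-congˡ g (λ t → below⁺ (ℕP.<-≤-trans (FinP.toℕ<n t) n≤R))

  sumOn-between : ∀ g {lo hi} → lo ℕ.≤ hi → sumOn (between lo hi) g ≡ sumBelow g hi - sumBelow g lo
  sumOn-between g {lo} {hi} lo≤hi = begin
    sumOn (between lo hi) g                                           ≡⟨ cancel (sumBelow g lo) (sumOn (between lo hi) g) ⟨
    (sumBelow g lo + sumOn (between lo hi) g) - sumBelow g lo       ≡⟨ cong (_- sumBelow g lo) (sumOn-∪ g disjoint) ⟨
    sumOn (below lo ∪ between lo hi) g - sumBelow g lo               ≡⟨ cong (_- sumBelow g lo) (sumOn-congˡ g split) ⟩
    sumBelow g hi - sumBelow g lo                                   ∎
    where
    open ≡-Reasoning
    cancel : ∀ a b → (a + b) - a ≡ b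
    cancel = solve-∀
    disjoint : Disjoint (below lo) (between lo hi)
    disjoint {t} t<lo = cong (_∧ below hi t) (dec-false (lo ℕ.≤? toℕ t) (ℕP.<⇒≱ (below⁻ t<lo)))
    split : ∀ t → (below lo ∪ between lo hi) t ≡ below hi t
    split t with below lo t in t<lo?
    ... | true  = sym (below⁺ (ℕP.<-≤-trans (below⁻ t<lo?) lo≤hi))
    ... | false = cong (_∧ below hi t) (dec-true (lo ℕ.≤? toℕ t) (¬below⁻ t<lo?))

  rangeSum≡sumBelow-sumBelow : ∀ (γ : Vec ℤ n) {lo hi} → lo ℕ.≤ hi →
    rangeSum γ lo hi ≡ sumBelow (lookup γ) hi - sumBelow (lookup γ) lo
  rangeSum≡sumBelow-sumBelow γ {lo} {hi} lo≤hi =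
    trans (sumFin≡∑ (λ t → [ does (lo ℕ.≤? toℕ t) ]· [ below hi t ]· lookup γ t))
          (trans (sum-cong-≗ λ t → ·-∧ (does (lo ℕ.≤? toℕ t)) (below hi t) (lookup γ t))
                 (sumOn-between (lookup γ) lo≤hi))

-- Flows along a list of edges

module _ {n : ℕ} where

  divergence : List ((Fin n × Fin n) × ℕ) → Fin n → ℤ
  divergence es t = foldr _+_ 0ℤ (map (contrib t) es)

  outflow : (Fin n → Bool) → (Fin n × Fin n) × ℕ → ℤ
  outflow A ((i , j) , m) = [ A i ]· + m - [ A j ]· + m

  Closed : List (Fin n × Fin n) → (Fin n → Bool) → Set
  Closed ps A = ∀ {i j} → (i , j) ∈ ps → A j ≡ true → A i ≡ true

  sumOn-contrib : ∀ A e → sumOn A (λ t → contrib t e) ≡ outflow A e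
  sumOn-contrib A ((i , j) , m) = trans (sumOn-- A _ _) (cong₂ _-_ (sumOn-·⁅⁆ A i (+ m)) (sumOn-·⁅⁆ A j (+ m)))

  sumOn-divergence : ∀ A es → sumOn A (divergence es) ≡ foldr _+_ 0ℤ (map (outflow A) es)
  sumOn-divergence A []       = sumOn-zero A
  sumOn-divergence A (e ∷ es) = trans (sumOn-+ A _ _) (cong₂ _+_ (sumOn-contrib A e) (sumOn-divergence A es))

  ∑-divergence : ∀ es → ∑[ t < n ] divergence es t ≡ 0ℤ
  ∑-divergence es = trans (sumOn-divergence (λ _ → true) es) (no-outflow es)
    where
    no-outflow : ∀ es → foldr _+_ 0ℤ (map (outflow (λ _ → true)) es) ≡ 0ℤ
    no-outflow []                   = refl
    no-outflow (((_ , _) , m) ∷ es) = cong₂ _+_ (ℤP.+-inverseʳ (+ m)) (no-outflow es)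

  outflow-nonneg : ∀ A {i j} m → (A j ≡ true → A i ≡ true) → 0ℤ ≤ outflow A ((i , j) , m)
  outflow-nonneg A {i} {j} m closed with A i | A j | closed
  ... | true  | true  | _ = ℤP.≤-reflexive (sym (ℤP.+-inverseʳ (+ m)))
  ... | true  | false | _ = +≤+ z≤n
  ... | false | false | _ = +≤+ z≤n
  ... | false | true  | closed′ with () ← closed′ refl

  outflow-leaving : ∀ {A i j} m → A i ≡ true → A j ≡ false → outflow A ((i , j) , m) ≡ + m
  outflow-leaving m Ai≡true Aj≡false rewrite Ai≡true | Aj≡false = ℤP.+-identityʳ (+ m)

  outflow-internal : ∀ {A i j} m → A i ≡ A j → outflow A ((i , j) , m) ≡ 0ℤ
  outflow-internal {A} {i} m Ai≡Aj rewrite Ai≡Aj = ℤP.+-inverseʳ ([ A _ ]· + m)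

  sumOn-divergence-nonneg : ∀ {ps A} → Closed ps A → ∀ ms → 0ℤ ≤ sumOn A (divergence (zip ps ms))
  sumOn-divergence-nonneg {ps} {A} closed ms = subst (0ℤ ≤_) (sym (sumOn-divergence A (zip ps ms))) (go closed ms)
    where
    go : ∀ {ps} → Closed ps A → ∀ ms → 0ℤ ≤ foldr _+_ 0ℤ (map (outflow A) (zip ps ms))
    go {[]}          _      _        = ℤP.≤-refl
    go {_ ∷ _}       _      []       = ℤP.≤-refl
    go {(i , j) ∷ _} closed (m ∷ ms) = ℤP.+-mono-≤ (outflow-nonneg A m (closed (here refl))) (go (closed ∘ there) ms)

  ∑-foldr-comm : ∀ {K} {X : Set} (F : Fin K → X → ℤ) xs →
    ∑[ k < K ] foldr _+_ 0ℤ (map (F k) xs) ≡ foldr _+_ 0ℤ (map (λ x → ∑[ k < K ] F k x) xs)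
  ∑-foldr-comm {K} F []       = sum-replicate-zero K
  ∑-foldr-comm {K} F (x ∷ xs) =
    trans (∑-distrib-+ (λ k → F k x) _) (cong (_+_ (∑[ k < K ] F k x)) (∑-foldr-comm F xs))

  sum≤∑-sumOn-divergence : ∀ {K ps} (P : Fin K → Fin n → Bool) → (∀ k → Closed ps (P k)) →
    (∀ {i j} → (i , j) ∈ ps → ∃ λ k → P k i ≡ true × P k j ≡ false) →
    ∀ ms → length ps ≡ length ms → + sum ms ≤ ∑[ k < K ] sumOn (P k) (divergence (zip ps ms))
  sum≤∑-sumOn-divergence {K} {ps} P closed leaves ms len≡ = begin
    + sum ms
      ≤⟨ go closed leaves ms len≡ ⟩
    foldr _+_ 0ℤ (map (λ e → ∑[ k < K ] outflow (P k) e) (zip ps ms))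
      ≡⟨ ∑-foldr-comm (outflow ∘ P) (zip ps ms) ⟨
    ∑[ k < K ] foldr _+_ 0ℤ (map (outflow (P k)) (zip ps ms))
      ≡⟨ sum-cong-≗ (λ k → sumOn-divergence (P k) (zip ps ms)) ⟨
    ∑[ k < K ] sumOn (P k) (divergence (zip ps ms))
      ∎
    where
    open ℤP.≤-Reasoning
    go : ∀ {ps} → (∀ k → Closed ps (P k)) →
      (∀ {i j} → (i , j) ∈ ps → ∃ λ k → P k i ≡ true × P k j ≡ false) → ∀ ms → length ps ≡ length ms →
      + sum ms ≤ foldr _+_ 0ℤ (map (λ e → ∑[ k < K ] outflow (P k) e) (zip ps ms))
    go {[]}          _      _      []       _    = ℤP.≤-refl
    go {(i , j) ∷ _} closed leaves (m ∷ ms) len≡ with leaves (here refl)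
    ... | k , Pki , ¬Pkj = ℤP.+-mono-≤
      (subst (_≤ ∑[ k′ < K ] outflow (P k′) ((i , j) , m)) (outflow-leaving {P k} m Pki ¬Pkj)
             (term≤∑ (λ k′ → outflow-nonneg (P k′) m (closed k′ (here refl))) k))
      (go (λ k → closed k ∘ there) (leaves ∘ there) ms (ℕP.suc-injective len≡))

incAt : ∀ {A : Set} {x : A} {xs} → x ∈ xs → List ℕ → List ℕ
incAt _         []       = []
incAt (here _)  (m ∷ ms) = suc m ∷ ms
incAt (there p) (m ∷ ms) = m ∷ incAt p ms

length-incAt : ∀ {A : Set} {x : A} {xs} (x∈ : x ∈ xs) ms → length (incAt x∈ ms) ≡ length ms
length-incAt _         []       = refl
length-incAt (here _)  (m ∷ ms) = refl
length-incAt (there p) (m ∷ ms) = cong suc (length-incAt p ms)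

sum-incAt : ∀ {A : Set} {x : A} {xs} (x∈ : x ∈ xs) ms → length xs ≡ length ms → sum (incAt x∈ ms) ≡ suc (sum ms)
sum-incAt (here _)  (m ∷ ms) _    = refl
sum-incAt (there p) (m ∷ ms) len≡ = trans (cong (m ℕ.+_) (sum-incAt p ms (ℕP.suc-injective len≡))) (ℕP.+-suc m (sum ms))

module _ {n : ℕ} where

  contrib-suc : ∀ (t : Fin n) e m → contrib t (e , suc m) ≡ contrib t (e , 1) + contrib t (e , m)
  contrib-suc t (i , j) m =
    trans (cong₂ _-_ (·-distrib-+ (⁅ i ⁆ t) (+ 1) (+ m)) (·-distrib-+ (⁅ j ⁆ t) (+ 1) (+ m)))
          (interchange ([ ⁅ i ⁆ t ]· + 1) ([ ⁅ i ⁆ t ]· + m) ([ ⁅ j ⁆ t ]· + 1) ([ ⁅ j ⁆ t ]· + m))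
    where
    interchange : ∀ a b c d → (a + b) - (c + d) ≡ (a - c) + (b - d)
    interchange = solve-∀

  divergence-incAt : ∀ {e : Fin n × Fin n} {ps} (e∈ : e ∈ ps) ms → length ps ≡ length ms → ∀ t →
    divergence (zip ps (incAt e∈ ms)) t ≡ contrib t (e , 1) + divergence (zip ps ms) t
  divergence-incAt {e} (here refl) (m ∷ ms) _ t =
    trans (cong (_+ _) (contrib-suc t e m)) (ℤP.+-assoc (contrib t (e , 1)) _ _)
  divergence-incAt {e} {e′ ∷ ps} (there e∈) (m ∷ ms) len≡ t =
    trans (cong (_+_ (contrib t (e′ , m))) (divergence-incAt e∈ ms (ℕP.suc-injective len≡) t))
          (swap (contrib t (e′ , m)) (contrib t (e , 1)) (divergence (zip ps ms) t))
    where
    swap : ∀ a b c → a + (b + c) ≡ b + (a + c)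
    swap = solve-∀

  divergence-zero : ∀ (ps : List (Fin n × Fin n)) t → divergence (zip ps (replicate (length ps) 0)) t ≡ 0ℤ
  divergence-zero []            t = refl
  divergence-zero ((i , j) ∷ ps) t = cong₂ _+_ (cong₂ _-_ (·-zero (⁅ i ⁆ t)) (·-zero (⁅ j ⁆ t))) (divergence-zero ps t)

  moved : Fin n × Fin n → (Fin n → ℤ) → Fin n → ℤ
  moved e g t = g t - contrib t (e , 1)

  sumOn-moved : ∀ A e g → sumOn A (moved e g) ≡ sumOn A g - outflow A (e , 1)
  sumOn-moved A e g = trans (sumOn-- A g (λ t → contrib t (e , 1))) (cong (_-_ (sumOn A g)) (sumOn-contrib A (e , 1)))

  0≤-outflow : ∀ (A : Fin n → Bool) {i j x} → (A i ≡ true → A j ≡ false → 0ℤ < x) → 0ℤ ≤ x →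
    0ℤ ≤ x - outflow A ((i , j) , 1)
  0≤-outflow A {i} {j} {x} crossing 0≤x with A i | A j | crossing
  ... | true  | true  | _        = subst (0ℤ ≤_) (sym (ℤP.+-identityʳ x)) 0≤x
  ... | true  | false | crossing = ℤP.i≤j⇒0≤j-i (ℤP.i<j⇒suc[i]≤j (crossing refl refl))
  ... | false | true  | _        = ℤP.+-mono-≤ 0≤x (+≤+ z≤n)
  ... | false | false | _        = subst (0ℤ ≤_) (sym (ℤP.+-identityʳ x)) 0≤x

  weight≡⇒ : ∀ ps ms {γ : Vec ℤ n} → weight ps ms ≡ γ → ∀ t → divergence (zip ps ms) t ≡ lookup γ t
  weight≡⇒ _ _ refl t = sym (VecP.lookup∘tabulate _ t)

  weight≡⇐ : ∀ ps ms {γ : Vec ℤ n} → (∀ t → divergence (zip ps ms) t ≡ lookup γ t) → weight ps ms ≡ γ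
  weight≡⇐ _ _ {γ} div≗γ = trans (VecP.tabulate-cong div≗γ) (VecP.tabulate∘lookup γ)

-- Coefficients of K count flows

sum-replicate-0 : ∀ l → sum (replicate l 0) ≡ 0
sum-replicate-0 zero    = refl
sum-replicate-0 (suc l) = sum-replicate-0 l

comps-sound : ∀ l d {ms} → ms ∈ comps l d → length ms ≡ l × sum ms ≡ d
comps-sound zero    zero (here refl) = refl , refl
comps-sound (suc l) d ms∈ with find (∈-concatMap⁻ (λ a → map (a ∷_) (comps l (d ∸ a))) {xs = upTo (suc d)} ms∈)
... | a , a∈ , ms∈′ with ∈-map⁻ (a ∷_) ms∈′
... | ms′ , ms′∈ , refl with comps-sound l (d ∸ a) ms′∈
... | len≡ , sum≡ = cong suc len≡ , trans (cong (a ℕ.+_) sum≡) (ℕP.m+[n∸m]≡n (ℕP.<⇒≤pred (∈-upTo⁻ a∈)))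

comps-complete : ∀ l d ms → length ms ≡ l → sum ms ≡ d → ms ∈ comps l d
comps-complete zero    zero []       refl refl = here refl
comps-complete (suc l) d  (a ∷ ms) len≡ refl =
  ∈-concatMap⁺ (λ a → map (a ∷_) (comps l (d ∸ a)))
    (lose (∈-upTo⁺ (s≤s (ℕP.m≤m+n a (sum ms))))
          (∈-map⁺ (a ∷_) (comps-complete l (d ∸ a) ms (ℕP.suc-injective len≡) (sym (ℕP.m+n∸m≡n a (sum ms))))))

module _ {A : Set} {P : A → Set} (P? : Decidable P) where

  length-filter≢0⇒Any : ∀ xs → length (filter P? xs) ≢ 0 → Any P xs
  length-filter≢0⇒Any xs ≢0 =
    decidable-stable (any? P? xs) (λ ¬any → ≢0 (cong length (ListP.filter-none P? (¬Any⇒All¬ xs ¬any))))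

  Any⇒length-filter≢0 : ∀ {xs} → Any P xs → length (filter P? xs) ≢ 0
  Any⇒length-filter≢0 any = ℕP.>⇒≢ (ListP.filter-some P? any)

  All¬⇒length-filter≡0 : ∀ {xs} → All (¬_ ∘ P) xs → length (filter P? xs) ≡ 0
  All¬⇒length-filter≡0 none = cong length (ListP.filter-none P? none)

module _ {n : ℕ} (η : List ℕ) (γ : Vec ℤ n) where

  private
    L = length (Φ n η)

    weight≟γ : ∀ ms → Dec (weight (Φ n η) ms ≡ γ)
    weight≟γ ms = VecP.≡-dec ℤ._≟_ (weight (Φ n η) ms) γ

  Kcoeff≢0⇒flow : ∀ {d} → Kcoeff η γ d ≢ 0 → ∃ λ ms → length ms ≡ L × sum ms ≡ d × weight (Φ n η) ms ≡ γ
  Kcoeff≢0⇒flow {d} ≢0 with find (length-filter≢0⇒Any weight≟γ (comps L d) ≢0)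
  ... | ms , ms∈ , w≡γ = ms , proj₁ (comps-sound L d ms∈) , proj₂ (comps-sound L d ms∈) , w≡γ

  flow⇒Kcoeff≢0 : ∀ ms → length ms ≡ L → weight (Φ n η) ms ≡ γ → Kcoeff η γ (sum ms) ≢ 0
  flow⇒Kcoeff≢0 ms len≡ w≡γ = Any⇒length-filter≢0 weight≟γ (lose (comps-complete L (sum ms) ms len≡ refl) w≡γ)

  no-flow⇒Kcoeff≡0 : ∀ {d} → (∀ ms → length ms ≡ L → sum ms ≡ d → weight (Φ n η) ms ≢ γ) → Kcoeff η γ d ≡ 0
  no-flow⇒Kcoeff≡0 {d} none = All¬⇒length-filter≡0 weight≟γ (All.tabulate λ ms∈ → uncurry (none _) (comps-sound L d ms∈))

r-mono : ∀ η {a b} → a ℕ.≤ b → r η a ℕ.≤ r η b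
r-mono []      {zero}  _         = z≤n
r-mono []      {suc a} _         = z≤n
r-mono (e ∷ η) {zero}  _         = z≤n
r-mono (e ∷ η) {suc a} (s≤s a≤b) = ℕP.+-monoʳ-≤ e (r-mono η a≤b)

r-cancel-< : ∀ η {a b} → r η a ℕ.< r η b → a ℕ.< b
r-cancel-< η {a} {b} ra<rb = ℕP.≰⇒> (λ b≤a → ℕP.<⇒≱ ra<rb (r-mono η b≤a))

r-strict : ∀ {η} → All (0 ℕ.<_) η → ∀ {k} → k ℕ.< length η → r η k ℕ.< r η (suc k)
r-strict {e ∷ η} (0<e All.∷ _)   {zero}  _         = ℕP.<-≤-trans 0<e (ℕP.m≤m+n e 0)
r-strict {e ∷ η} (_ All.∷ 0<η)   {suc k} (s≤s k<p) = ℕP.+-monoʳ-< e (r-strict 0<η k<p)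

r-sum : ∀ η {k} → length η ℕ.≤ k → r η k ≡ sum η
r-sum []      {zero}  _         = refl
r-sum []      {suc k} _         = refl
r-sum (e ∷ η) {suc k} (s≤s p≤k) = cong (e ℕ.+_) (r-sum η p≤k)

block-of : ∀ η {x} m → x ℕ.< r η m → ∃ λ b → b ℕ.< m × r η b ℕ.≤ x × x ℕ.< r η (suc b)
block-of η {x} (suc m) x<r with x ℕ.<? r η m
... | yes x<rm = let b , b<m , in-b = block-of η m x<rm in b , ℕP.m<n⇒m<1+n b<m , in-b
... | no x≮rm  = m , ℕP.n<1+n m , ℕP.≮⇒≥ x≮rm , x<r

module _ {n : ℕ} (η : List ℕ) {i j : Fin n} where

  ∈Φ⁻ : (i , j) ∈ Φ n η → ∃ λ k → k ℕ.< length η × toℕ i ℕ.< r η (suc k) × r η (suc k) ℕ.≤ toℕ j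
  ∈Φ⁻ ij∈ =
    AnyP.applyUpTo⁻ id (AnyP.map⁻ (proj₂ (∈-filter⁻ _ {xs = List.cartesianProduct (List.allFin n) (List.allFin n)} ij∈)))

  ∈Φ⁺ : ∀ {k} → k ℕ.< length η → toℕ i ℕ.< r η (suc k) → r η (suc k) ℕ.≤ toℕ j → (i , j) ∈ Φ n η
  ∈Φ⁺ k<p i<r r≤j =
    ∈-filter⁺ _ (∈-cartesianProduct⁺ (∈-allFin i) (∈-allFin j)) (AnyP.map⁺ (AnyP.applyUpTo⁺ id (i<r , r≤j) k<p))

-- The set Y_η and the degree

module Composition {n : ℕ} (η : List ℕ) (sum≡n : sum η ≡ n) where

  p L : ℕ
  p = length η
  L = length (Φ n η)

  r≡n : ∀ {k} → p ℕ.≤ k → r η k ≡ n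
  r≡n p≤k = trans (r-sum η p≤k) sum≡n

  partialSum : (Fin n → ℤ) → ℕ → ℤ
  partialSum g k = sumBelow g (r η k)

  deg : (Fin n → ℤ) → ℤ
  deg g = ∑[ k < p ] partialSum g (toℕ k)

  deg-cong : ∀ {g h} → (∀ t → g t ≡ h t) → deg g ≡ deg h
  deg-cong g≗h = sum-cong-≗ {p} (λ k → sumOn-congʳ (below (r η (toℕ k))) g≗h)

  -- The sets {1..r_l} ∪ Ω_l of the definition of Y_η, with Ω_l inside the (l+1)-st block.
  LevelSet : ℕ → (Fin n → Bool) → Set
  LevelSet l A = below (r η l) ⊆ A × A ⊆ below (r η (suc l))

  levelSet-below : ∀ l → LevelSet l (below (r η l))
  levelSet-below l = id , λ t<r → below⁺ (ℕP.<-≤-trans (below⁻ t<r) (r-mono η (ℕP.n≤1+n l)))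

  levelSet-inside : ∀ {l A t} → LevelSet l A → A t ≡ true → toℕ t ℕ.< r η (suc l)
  levelSet-inside (_ , A⊆below) = below⁻ ∘ A⊆below

  levelSet-outside : ∀ {l A t} → LevelSet l A → A t ≡ false → r η l ℕ.≤ toℕ t
  levelSet-outside {l} {A} {t} (below⊆A , _) At≡false with below (r η l) t in t<r
  ... | true  = contradiction (trans (sym (below⊆A t<r)) At≡false) λ ()
  ... | false = ¬below⁻ t<r

  levelSet-insert : ∀ {l A t} → LevelSet l A → toℕ t ℕ.< r η (suc l) → LevelSet l (A ∪ ⁅ t ⁆)
  levelSet-insert {l} {A} {t} (below⊆A , A⊆below) t<r = (λ u<r → cong (_∨ ⁅ t ⁆ _) (below⊆A u<r)) , A∪t⊆below
    where
    A∪t⊆below : A ∪ ⁅ t ⁆ ⊆ below (r η (suc l))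
    A∪t⊆below {u} inside with A u in Au
    ... | true  = A⊆below Au
    ... | false = subst (λ v → below (r η (suc l)) v ≡ true) (⁅⁆⁻ inside) (below⁺ t<r)

  levelSet-remove : ∀ {l A i} → LevelSet l A → r η l ℕ.≤ toℕ i → LevelSet l (A ∖ ⁅ i ⁆)
  levelSet-remove {l} {A} {i} (below⊆A , A⊆below) r≤i = below⊆A∖i , A⊆below ∘ BoolP.∧-conicalˡ _ _
    where
    below⊆A∖i : below (r η l) ⊆ A ∖ ⁅ i ⁆
    below⊆A∖i {u} u<r = cong₂ _∧_ (below⊆A u<r)
      (cong not (dec-false (i ≟ u) λ { refl → ℕP.<⇒≱ (below⁻ u<r) r≤i }))

  levelSet-closed : ∀ {l A} → LevelSet l A → Closed (Φ n η) A
  levelSet-closed {l} LA ij∈ Aj with ∈Φ⁻ η ij∈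
  ... | k , _ , i<r , r≤j = proj₁ LA (below⁺ (ℕP.<-≤-trans i<r (r-mono η sk≤l)))
    where
    sk≤l : suc k ℕ.≤ l
    sk≤l = ℕP.≤-pred (r-cancel-< η (ℕP.≤-<-trans r≤j (levelSet-inside LA Aj)))

  below-closed : ∀ R → Closed (Φ n η) (below R)
  below-closed R {i} ij∈ j<R with ∈Φ⁻ η ij∈
  ... | _ , _ , i<r , r≤j = below⁺ {R = R} {i} (ℕP.<-trans (ℕP.<-≤-trans i<r r≤j) (below⁻ {R = R} j<R))

  record IsY (g : Fin n → ℤ) : Set where
    field
      ∑≡0             : ∑[ t < n ] g t ≡ 0ℤ
      levelSet-nonneg : ∀ {l A} → l ℕ.< p → LevelSet l A → 0ℤ ≤ sumOn A g

  open IsY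

  IsY-resp : ∀ {g h} → (∀ t → g t ≡ h t) → IsY g → IsY h
  IsY-resp g≗h Yg = record
    { ∑≡0             = trans (sum-cong-≗ (sym ∘ g≗h)) (∑≡0 Yg)
    ; levelSet-nonneg = λ l<p LA → subst (0ℤ ≤_) (sumOn-congʳ _ g≗h) (levelSet-nonneg Yg l<p LA)
    }

  IsY⇒partialSum-nonneg : ∀ {g} → IsY g → ∀ k → 0ℤ ≤ partialSum g k
  IsY⇒partialSum-nonneg {g} Yg k with k ℕ.<? p
  ... | yes k<p = levelSet-nonneg Yg k<p (levelSet-below k)
  ... | no k≮p  =
    ℤP.≤-reflexive (sym (trans (sumBelow-full g (ℕP.≤-reflexive (sym (r≡n (ℕP.≮⇒≥ k≮p))))) (∑≡0 Yg)))

  IsY⇒deg-nonneg : ∀ {g} → IsY g → 0ℤ ≤ deg g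
  IsY⇒deg-nonneg {g} Yg = ∑-nonneg {p} {partialSum g ∘ toℕ} (IsY⇒partialSum-nonneg Yg ∘ toℕ)

  InY⇒IsY : ∀ {γ} → InY η γ → IsY (lookup γ)
  InY⇒IsY {γ} (sumVec≡0 , Y) = record
    { ∑≡0             = trans (sym (sumFin≡∑ g)) sumVec≡0
    ; levelSet-nonneg = λ {l} {A} l<p LA →
        subst (0ℤ ≤_) (split l A (proj₁ LA)) (Y l l<p (Vec.tabulate (A ∖ below (r η l))) (in-block LA))
    }
    where
    g = lookup γ
    in-block : ∀ {l A} → LevelSet l A → ∀ a → a ∈ₛ Vec.tabulate (A ∖ below (r η l)) →
      r η l ℕ.≤ toℕ a × toℕ a ℕ.< r η (suc l)
    in-block {l} {A} LA a a∈ =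
      ¬below⁻ (trans (sym (BoolP.not-involutive _)) (cong not (BoolP.∧-conicalʳ _ _ inside))) ,
      levelSet-inside LA (BoolP.∧-conicalˡ _ _ inside)
      where
      inside : (A ∖ below (r η l)) a ≡ true
      inside = trans (sym (VecP.lookup∘tabulate (A ∖ below (r η l)) a)) (VecP.[]=⇒lookup a∈)
    -- rangeSum γ 0 R computes to sumBelow (lookup γ) R because 0 ≤? x always reduces to yes.
    split : ∀ l A → below (r η l) ⊆ A →
      rangeSum γ 0 (r η l) + subsetSum γ (Vec.tabulate (A ∖ below (r η l))) ≡ sumOn A g
    split l A below⊆A = trans
      (cong₂ _+_ (sumFin≡∑ (λ t → [ below (r η l) t ]· g t))
                 (trans (sumFin≡∑ (λ t → [ lookup (Vec.tabulate (A ∖ below (r η l))) t ]· g t))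
                        (sumOn-congˡ g (VecP.lookup∘tabulate (A ∖ below (r η l))))))
      (sym (sumOn-split g below⊆A))

  IsY⇒InY : ∀ {γ} → IsY (lookup γ) → InY η γ
  IsY⇒InY {γ} Yg = trans (sumFin≡∑ g) (∑≡0 Yg) , λ k k<p Ω Ω⊆block →
    subst (0ℤ ≤_) (split k Ω Ω⊆block) (levelSet-nonneg Yg k<p (levelSet k Ω Ω⊆block))
    where
    g = lookup γ
    InBlock : ℕ → Subset n → Set
    InBlock k Ω = ∀ a → a ∈ₛ Ω → r η k ℕ.≤ toℕ a × toℕ a ℕ.< r η (suc k)
    levelSet : ∀ k Ω → InBlock k Ω → LevelSet k (below (r η k) ∪ lookup Ω)
    levelSet k Ω Ω⊆block = (λ {t} t<r → cong (_∨ lookup Ω t) t<r) , ⊆below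
      where
      ⊆below : below (r η k) ∪ lookup Ω ⊆ below (r η (suc k))
      ⊆below {t} inside with below (r η k) t in t<r
      ... | true  = below⁺ (ℕP.<-≤-trans (below⁻ t<r) (r-mono η (ℕP.n≤1+n k)))
      ... | false = below⁺ (proj₂ (Ω⊆block t (VecP.lookup⇒[]= t Ω inside)))
    split : ∀ k Ω → InBlock k Ω → sumOn (below (r η k) ∪ lookup Ω) g ≡ rangeSum γ 0 (r η k) + subsetSum γ Ω
    split k Ω Ω⊆block = trans (sumOn-∪ g disjoint)
      (sym (cong₂ _+_ (sumFin≡∑ (λ t → [ below (r η k) t ]· g t)) (sumFin≡∑ (λ t → [ lookup Ω t ]· g t))))
      where
      disjoint : Disjoint (below (r η k)) (lookup Ω)
      disjoint {t} t<r with lookup Ω t in t∈Ω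
      ... | true  = contradiction (proj₁ (Ω⊆block t (VecP.lookup⇒[]= t Ω t∈Ω))) (ℕP.<⇒≱ (below⁻ t<r))
      ... | false = refl

  divergence-IsY : ∀ ms → IsY (divergence (zip (Φ n η) ms))
  divergence-IsY ms = record
    { ∑≡0             = ∑-divergence (zip (Φ n η) ms)
    ; levelSet-nonneg = λ _ LA → sumOn-divergence-nonneg (levelSet-closed LA) ms
    }

  sum≤deg : ∀ ms → length ms ≡ L → + sum ms ≤ deg (divergence (zip (Φ n η) ms))
  sum≤deg ms len≡ =
    sum≤∑-sumOn-divergence (λ k → below (r η (toℕ k))) (λ k → below-closed (r η (toℕ k))) leaves ms (sym len≡)
    where
    leaves : ∀ {i j} → (i , j) ∈ Φ n η → ∃ λ k → below (r η (toℕ k)) i ≡ true × below (r η (toℕ k)) j ≡ false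
    leaves {i} {j} ij∈ with ∈Φ⁻ η ij∈
    ... | k , _ , i<r , r≤j = fromℕ< sk<p ,
          subst (λ x → below (r η x) i ≡ true)  (sym (FinP.toℕ-fromℕ< sk<p)) (below⁺ i<r) ,
          subst (λ x → below (r η x) j ≡ false) (sym (FinP.toℕ-fromℕ< sk<p)) (¬below⁺ r≤j)
      where
      sk<p : suc k ℕ.< p
      sk<p = r-cancel-< η (ℕP.≤-<-trans r≤j (subst (toℕ j ℕ.<_) (sym (r≡n ℕP.≤-refl)) (FinP.toℕ<n j)))

  degFormula≡deg : ∀ γ → degFormula η γ ≡ deg (lookup γ)
  degFormula≡deg γ = begin
    foldr _+_ 0ℤ (map F (map suc (upTo (p ∸ 1))))
      ≡⟨ cong (foldr _+_ 0ℤ) (ListP.map-∘ (upTo (p ∸ 1))) ⟨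
    foldr _+_ 0ℤ (map (F ∘ suc) (upTo (p ∸ 1)))
      ≡⟨ cong (foldr _+_ 0ℤ ∘ map (F ∘ suc)) (applyUpTo≡tabulate id (p ∸ 1)) ⟩
    foldr _+_ 0ℤ (map (F ∘ suc) (List.tabulate {n = p ∸ 1} toℕ))
      ≡⟨ cong (foldr _+_ 0ℤ) (ListP.map-tabulate {n = p ∸ 1} toℕ (F ∘ suc)) ⟩
    foldr _+_ 0ℤ (List.tabulate {n = p ∸ 1} (F ∘ suc ∘ toℕ))
      ≡⟨ foldr-+-tabulate {p ∸ 1} (F ∘ suc ∘ toℕ) ⟩
    ∑[ x < p ∸ 1 ] F (suc (toℕ x))
      ≡⟨ sum-cong-≗ {p ∸ 1} (λ x →
           cong (+ (p ∸ suc (toℕ x)) *_) (rangeSum≡sumBelow-sumBelow γ (r-mono η (ℕP.n≤1+n (toℕ x))))) ⟩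
    ∑[ x < p ∸ 1 ] (+ (p ∸ suc (toℕ x)) * (partialSum g (suc (toℕ x)) - partialSum g (toℕ x)))
      ≡⟨ ∑-by-parts p (partialSum g) (sumBelow-0 g) ⟩
    deg g ∎
    where
    open ≡-Reasoning
    g = lookup γ
    F : ℕ → ℤ
    F k = + (p ∸ k) * rangeSum γ (r η (k ∸ 1)) (r η k)

  IsY∧deg≡0⇒≡0 : ∀ {g} → IsY g → deg g ≡ 0ℤ → ∀ t → g t ≡ 0ℤ
  IsY∧deg≡0⇒≡0 {g} Yg deg≡0 t = ℤP.≤-antisym (subst (g t ≤_) (∑≡0 Yg) (term≤∑ entry-nonneg t)) (entry-nonneg t)
    where
    partialSum≡0 : ∀ {k} → k ℕ.< p → partialSum g k ≡ 0ℤ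
    partialSum≡0 {k} k<p = ℤP.≤-antisym
      (subst (partialSum g k ≤_) deg≡0 (term≤∑-toℕ (IsY⇒partialSum-nonneg Yg) k<p))
      (IsY⇒partialSum-nonneg Yg k)
    entry-nonneg : ∀ t → 0ℤ ≤ g t
    entry-nonneg t with block-of η p (subst (toℕ t ℕ.<_) (sym (r≡n ℕP.≤-refl)) (FinP.toℕ<n t))
    ... | b , b<p , r≤t , t<r = subst (0ℤ ≤_) singleton (levelSet-nonneg Yg b<p (levelSet-insert (levelSet-below b) t<r))
      where
      singleton : sumOn (below (r η b) ∪ ⁅ t ⁆) g ≡ g t
      singleton = trans (sumOn-insert g (¬below⁺ r≤t))
                        (trans (cong (_+ g t) (partialSum≡0 b<p)) (ℤP.+-identityˡ (g t)))

  ascent-of-partialSum : ∀ {g} → 0ℤ < deg g → ∃ λ c → suc c ℕ.< p × partialSum g c < partialSum g (suc c)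
  ascent-of-partialSum {g} 0<deg with ∑-pos⇒∃-pos 0<deg
  ... | k , 0<Sk with ascent (partialSum g) (toℕ k) (subst (_< partialSum g (toℕ k)) (sym (sumBelow-0 g)) 0<Sk)
  ...   | c , c<k , up = c , ℕP.≤-<-trans c<k (FinP.toℕ<n k) , up

  module _ (pos : All (0 ℕ.<_) η) where

    record Move (g : Fin n → ℤ) : Set where
      field
        edge      : Fin n × Fin n
        edge∈Φ    : edge ∈ Φ n η
        isY       : IsY (moved edge g)
        deg-moved : deg (moved edge g) ≡ deg g - 1ℤ

    module _ {g} (Yg : IsY g) {c} (sc<p : suc c ℕ.< p) where

      c<p : c ℕ.< p
      c<p = ℕP.<-trans (ℕP.n<1+n c) sc<p

      record Source : Set where
        field
          i      : Fin n
          r≤i    : r η c ℕ.≤ toℕ i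
          i<r    : toℕ i ℕ.< r η (suc c)
          inside : ∀ {A} → LevelSet c A → A i ≡ true → 0ℤ < sumOn A g

      record Sink : Set where
        field
          j       : Fin n
          r≤j     : r η (suc c) ℕ.≤ toℕ j
          j<r     : toℕ j ℕ.< r η (suc (suc c))
          outside : ∀ {A} → LevelSet (suc c) A → A j ≡ false → 0ℤ < sumOn A g

      source : partialSum g c < partialSum g (suc c) → Source
      source up with sumOn-pos⇒∃ (between (r η c) (r η (suc c))) g
                       (subst (0ℤ <_) (sym (sumOn-between g (r-mono η (ℕP.n≤1+n c)))) 0<difference)
        where
        0<difference : 0ℤ < partialSum g (suc c) - partialSum g c
        0<difference = subst (_< partialSum g (suc c) - partialSum g c) (ℤP.+-inverseʳ (partialSum g c))
                             (ℤP.+-monoˡ-< (- partialSum g c) up)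
      ... | i , i∈ , 0<gi = record { i = i ; r≤i = r≤i ; i<r = proj₂ (between⁻ {lo = r η c} i∈) ; inside = inside }
        where
        r≤i : r η c ℕ.≤ toℕ i
        r≤i = proj₁ (between⁻ {hi = r η (suc c)} i∈)
        inside : ∀ {A} → LevelSet c A → A i ≡ true → 0ℤ < sumOn A g
        inside LA Ai = subst (0ℤ <_) (sym (sumOn-remove g Ai))
          (ℤP.+-mono-<-≤ 0<gi (levelSet-nonneg Yg c<p (levelSet-remove LA r≤i)))

      -- j is a negative entry of the next block if there is one, and its first entry otherwise.
      sink : partialSum g c < partialSum g (suc c) → Sink
      sink up with FinP.any? (λ t →
        (r η (suc c) ℕ.≤? toℕ t) ×-dec (toℕ t ℕ.<? r η (suc (suc c))) ×-dec (g t ℤP.<? 0ℤ))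
      ... | yes (j , r≤j , j<r , gj<0) = record { j = j ; r≤j = r≤j ; j<r = j<r ; outside = outside }
        where
        outside : ∀ {A} → LevelSet (suc c) A → A j ≡ false → 0ℤ < sumOn A g
        outside {A} LA Aj = ℤP.≤-<-trans
          (subst (0ℤ ≤_) (sumOn-insert g Aj) (levelSet-nonneg Yg sc<p (levelSet-insert LA j<r)))
          (subst (sumOn A g + g j <_) (ℤP.+-identityʳ (sumOn A g)) (ℤP.+-monoʳ-< (sumOn A g) gj<0))
      ... | no none = record { j = fromℕ< r<n ; r≤j = ℕP.≤-reflexive (sym (FinP.toℕ-fromℕ< r<n))
                             ; j<r = subst (ℕ._< r η (suc (suc c))) (sym (FinP.toℕ-fromℕ< r<n)) (r-strict pos sc<p)
                             ; outside = λ LA _ →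
                                 ℤP.<-≤-trans (ℤP.≤-<-trans (IsY⇒partialSum-nonneg Yg c) up) (partialSum≤ LA) }
        where
        r<n : r η (suc c) ℕ.< n
        r<n = ℕP.<-≤-trans (r-strict pos sc<p) (ℕP.≤-trans (r-mono η sc<p) (ℕP.≤-reflexive (r≡n ℕP.≤-refl)))
        partialSum≤ : ∀ {A} → LevelSet (suc c) A → partialSum g (suc c) ≤ sumOn A g
        partialSum≤ LA = sumOn-mono (proj₁ LA) λ {t} At t≮r →
          ℤP.≮⇒≥ (λ gt<0 → none (t , ¬below⁻ t≮r , levelSet-inside LA At , gt<0))

      module SourceToSink (src : Source) (snk : Sink) where

        open Source src
        open Sink snk


        crossing : ∀ {l A} → l ℕ.< p → LevelSet l A → A i ≡ true → A j ≡ false → 0ℤ < sumOn A g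
        crossing {l} l<p LA Ai Aj with squeeze c≤l l≤sc
          where
          c≤l : c ℕ.≤ l
          c≤l = ℕP.≤-pred (r-cancel-< η (ℕP.≤-<-trans r≤i (levelSet-inside LA Ai)))
          l≤sc : l ℕ.≤ suc c
          l≤sc = ℕP.≤-pred (r-cancel-< η (ℕP.≤-<-trans (levelSet-outside LA Aj) j<r))
        ... | inj₁ refl = inside LA Ai
        ... | inj₂ refl = outside LA Aj

        moved-IsY : IsY (moved (i , j) g)
        moved-IsY = record
          { ∑≡0             = trans (sumOn-moved (λ _ → true) (i , j) g)
                                      (cong (_- outflow (λ _ → true) ((i , j) , 1)) (∑≡0 Yg))
          ; levelSet-nonneg = λ {_} {A} l<p LA →
              subst (0ℤ ≤_) (sym (sumOn-moved A (i , j) g)) (0≤-outflow A (crossing l<p LA) (levelSet-nonneg Yg l<p LA))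
          }

        deg-moved : deg (moved (i , j) g) ≡ deg g - 1ℤ
        deg-moved = begin
          deg (moved (i , j) g)
            ≡⟨ sum-cong-≗ {p} (λ k → sumOn-moved (below (r η (toℕ k))) (i , j) g) ⟩
          ∑[ k < p ] (partialSum g (toℕ k) - outflow (below (r η (toℕ k))) ((i , j) , 1))
            ≡⟨ ∑-distrib-- {p} (partialSum g ∘ toℕ) (λ k → outflow (below (r η (toℕ k))) ((i , j) , 1)) ⟩
          deg g - ∑[ k < p ] outflow (below (r η (toℕ k))) ((i , j) , 1)
            ≡⟨ cong (_-_ (deg g)) (∑-single-toℕ {p} {λ k → outflow (below (r η k)) ((i , j) , 1)} sc<p internal) ⟩
          deg g - outflow (below (r η (suc c))) ((i , j) , 1)
            ≡⟨ cong (_-_ (deg g)) (outflow-leaving {A = below (r η (suc c))} 1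
                                    (below⁺ {R = r η (suc c)} i<r) (¬below⁺ {R = r η (suc c)} r≤j)) ⟩
          deg g - 1ℤ ∎
          where
          open ≡-Reasoning
          i<j : toℕ i ℕ.< toℕ j
          i<j = ℕP.<-≤-trans i<r r≤j
          internal : ∀ k → k ≢ suc c → outflow (below (r η k)) ((i , j) , 1) ≡ 0ℤ
          internal k k≢sc with ℕP.<-cmp k (suc c)
          ... | tri< k<sc _ _ = outflow-internal {A = below (r η k)} 1
            (trans (¬below⁺ {R = r η k} r≤i′) (sym (¬below⁺ {R = r η k} (ℕP.≤-trans r≤i′ (ℕP.<⇒≤ i<j)))))
            where
            r≤i′ : r η k ℕ.≤ toℕ i
            r≤i′ = ℕP.≤-trans (r-mono η (ℕP.≤-pred k<sc)) r≤i
          ... | tri≈ _ k≡sc _ = contradiction k≡sc k≢sc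
          ... | tri> _ _ sc<k = outflow-internal {A = below (r η k)} 1
            (trans (below⁺ {R = r η k} (ℕP.<-trans i<j j<r′)) (sym (below⁺ {R = r η k} j<r′)))
            where
            j<r′ : toℕ j ℕ.< r η k
            j<r′ = ℕP.<-≤-trans j<r (r-mono η sc<k)

        move : Move g
        move = record { edge = i , j ; edge∈Φ = ∈Φ⁺ η c<p i<r r≤j ; isY = moved-IsY ; deg-moved = deg-moved }

    move : ∀ {g} → IsY g → 0ℤ < deg g → Move g
    move Yg 0<deg with ascent-of-partialSum 0<deg
    ... | c , sc<p , up = SourceToSink.move Yg sc<p (source Yg sc<p up) (sink Yg sc<p up)

    optimalFlow : ∀ D {g} → IsY g → deg g ≡ + D →
      ∃ λ ms → length ms ≡ L × sum ms ≡ D × (∀ t → divergence (zip (Φ n η) ms) t ≡ g t)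
    optimalFlow zero Yg deg≡0 =
      replicate L 0 , ListP.length-replicate L , sum-replicate-0 L ,
      λ t → trans (divergence-zero (Φ n η) t) (sym (IsY∧deg≡0⇒≡0 Yg deg≡0 t))
    optimalFlow (suc D) {g} Yg deg≡ = extend (move Yg (subst (0ℤ <_) (sym deg≡) (+<+ (s≤s z≤n))))
      where
      extend : Move g → ∃ λ ms → length ms ≡ L × sum ms ≡ suc D × (∀ t → divergence (zip (Φ n η) ms) t ≡ g t)
      extend s =
        let ms , len≡ , sum≡ , div≗ = optimalFlow D isY (trans deg-moved (cong (_- 1ℤ) deg≡))
        in  incAt edge∈Φ ms ,
            trans (length-incAt edge∈Φ ms) len≡ ,
            trans (sum-incAt edge∈Φ ms (sym len≡)) (cong suc sum≡) ,
            λ t → trans (divergence-incAt edge∈Φ ms (sym len≡) t)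
                        (trans (cong (_+_ (contrib t (edge , 1))) (div≗ t)) (restore (contrib t (edge , 1)) (g t)))
        where
        open Move s
        restore : ∀ c x → c + (x - c) ≡ x
        restore = solve-∀

    InY⇒optimalFlow : ∀ {γ} → InY η γ →
      ∃ λ ms → length ms ≡ L × + sum ms ≡ deg (lookup γ) × weight (Φ n η) ms ≡ γ
    InY⇒optimalFlow {γ} y =
      let ms , len≡ , sum≡ , div≗ = optimalFlow ℤ.∣ deg (lookup γ) ∣ Yg (sym +∣deg∣≡deg)
      in  ms , len≡ , trans (cong +_ sum≡) +∣deg∣≡deg , weight≡⇐ (Φ n η) ms div≗
      where
      Yg = InY⇒IsY {γ} y
      +∣deg∣≡deg = ℤP.0≤i⇒+∣i∣≡i (IsY⇒deg-nonneg Yg)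

    InY⇒KNonZero : ∀ {γ} → InY η γ → KNonZero η γ
    InY⇒KNonZero {γ} y =
      let ms , len≡ , _ , w≡γ = InY⇒optimalFlow {γ} y in sum ms , flow⇒Kcoeff≢0 η γ ms len≡ w≡γ

  KNonZero⇒InY : ∀ {γ} → KNonZero η γ → InY η γ
  KNonZero⇒InY {γ} (_ , K≢0) =
    let ms , _ , _ , w≡γ = Kcoeff≢0⇒flow η γ K≢0
    in  IsY⇒InY {γ} (IsY-resp (weight≡⇒ (Φ n η) ms w≡γ) (divergence-IsY ms))

  Kcoeff-above-deg : ∀ {γ d} → deg (lookup γ) < + d → Kcoeff η γ d ≡ 0
  Kcoeff-above-deg {γ} deg<d = no-flow⇒Kcoeff≡0 η γ λ ms len≡ sum≡d w≡γ →
    ℤP.<⇒≱ (subst (λ d → deg (lookup γ) < + d) (sym sum≡d) deg<d)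
            (subst (+ sum ms ≤_) (deg-cong (weight≡⇒ (Φ n η) ms w≡γ)) (sum≤deg ms len≡))

-- The hypothesis Σγ = 0 is unused: it is also a component of InY η γ.
theorem3p15 : (n : ℕ) (η : List ℕ) → All (λ e → 0 ℕ.< e) η → sum η ≡ n →
    (γ : Vec ℤ n) → sumVec γ ≡ 0ℤ →
    (KNonZero η γ ⇔ InY η γ) ×
    (InY η γ → ∃ λ D → IsDegree (Kcoeff η γ) D × (+ D ≡ degFormula η γ))
theorem3p15 n η pos sum≡n γ _ = mk⇔ KNonZero⇒InY (InY⇒KNonZero pos) , degree
  where
  open Composition η sum≡n
  degree : InY η γ → ∃ λ D → IsDegree (Kcoeff η γ) D × (+ D ≡ degFormula η γ)
  degree y =
    let ms , len≡ , sum≡deg , w≡γ = InY⇒optimalFlow pos {γ} y in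
    sum ms , (flow⇒Kcoeff≢0 η γ ms len≡ w≡γ , λ d sum<d → Kcoeff-above-deg (subst (_< + d) sum≡deg (+<+ sum<d))) ,
    trans sum≡deg (sym (degFormula≡deg γ))
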